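{- Let $\kappa,\lambda,\nu\in\mathbb Z^r$ be $r$-row generalized partitions such that $\lambda=\kappa+\mathbf e_S$ and $\nu=\lambda+\mathbf e_T$ for some $S,T\in\mathcal A_r$. Let $\mu=\mathrm{sort}(\nu+\kappa-\lambda)$. Then $\lambda=\mathrm{sort}(\nu+\kappa-\mu)$.
   Context: An $r$-row generalized partition is $\lambda=(\lambda_1,\ldots,\lambda_r)\in\mathbb Z^r$ with $\lambda_1\ge\cdots\ge\lambda_r$. $\mathcal A_r$ is the set of subsets $S\subseteq\{\pm1,\ldots,\pm r\}$ all of whose elements have the same sign (including $\emptyset$); $\mathbf e_S=\sum_{s\in S}\mathbf e_s$ if $S$ is positive and $\mathbf e_S=-\sum_{s\in S}\mathbf e_{ -s}$ if negative, with $\mathbf e_1,\ldots,\mathbf e_r$ the standard basis. For $\alpha\in\mathbb Z^r$, $\mathrm{sort}(\alpha)$ is its weakly decreasing rearrangement; addition and subtraction are coordinatewise. -}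

module Defs where

open import Data.Nat using (ℕ; zero; suc)
open import Data.Integer using (ℤ; _+_; _-_; -_; _≤_; _≤?_; 0ℤ; 1ℤ)
open import Data.Vec using (Vec; []; _∷_; zipWith; map)
open import Data.Bool using (Bool; true; false; if_then_else_)
open import Data.Fin using (Fin)
open import Data.Fin.Subset using (Subset)
open import Relation.Nullary using (yes; no)
open import Data.Unit using (⊤)
open import Data.Product using (_×_)

IsGenPartition : ∀ {r} → Vec ℤ r → Set
IsGenPartition [] = ⊤
IsGenPartition (x ∷ []) = ⊤
IsGenPartition (x ∷ y ∷ xs) = (y ≤ x) × IsGenPartition (y ∷ xs)

-- An element of 𝒜_r: a sign together with a subset of {1..r}.
-- (positive, A) encodes S = {+a : a ∈ A}; (negative, A) encodes S = {-a : a ∈ A}.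
-- The empty set is encoded (redundantly) by either sign with A = ∅; e_S = 0 in both cases.
data Sign : Set where
  pos neg : Sign

record SignedSubset (r : ℕ) : Set where
  constructor _,_
  field
    sign : Sign
    elems : Subset r

indicator : ∀ {r} → Subset r → Vec ℤ r
indicator = map (λ b → if b then 1ℤ else 0ℤ)

e : ∀ {r} → SignedSubset r → Vec ℤ r
e (pos , A) = indicator A
e (neg , A) = map -_ (indicator A)

_⊕_ : ∀ {r} → Vec ℤ r → Vec ℤ r → Vec ℤ r
_⊕_ = zipWith _+_

_⊖_ : ∀ {r} → Vec ℤ r → Vec ℤ r → Vec ℤ r
_⊖_ = zipWith _-_

infixl 6 _⊕_ _⊖_

insert : ∀ {n} → ℤ → Vec ℤ n → Vec ℤ (suc n)
insert x [] = x ∷ []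
insert x (y ∷ ys) with y ≤? x
... | yes _ = x ∷ y ∷ ys
... | no _ = y ∷ insert x ys

sort : ∀ {n} → Vec ℤ n → Vec ℤ n
sort [] = []
sort (x ∷ xs) = insert x (sort xs)

{-# OPTIONS --safe #-}
-- Put f = ν + κ and x = f − λ, so that μ = sort x and the claim reads
-- λ = sort (f − sort x).  Two facts make this true.
--
-- Rearrangement: if f is weakly decreasing and f i = f j whenever i < j and
-- x i < x j, then f − sort x is a permutation of f − x = λ.  Insertion sort
-- only moves an entry of x past larger entries, and those sit at positions
-- where f takes the same value as at the entry's own position.  As λ is
-- sorted, sorting f − sort x gives back λ.
--
-- The hypothesis: write λ = κ + s and ν = λ + t, where the entries of s lie in
-- {0, ε} and those of t in {0, δ} for fixed signs ε, δ.  Then x i = κ i + t i.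
-- If i < j and x i < x j, then κ j ≤ κ i forces t j = t i + 1 and κ i = κ j;
-- now ν j ≤ ν i forces s i = s j + 1, so f i = 2 κ i + s i + t i = f j.
module Submission where

open import Defs
open import Data.Bool using (Bool; true; false; if_then_else_)
open import Data.Empty using (⊥; ⊥-elim)
open import Data.Integer using (ℤ; _+_; _-_; -_; _≤_; _<_; _≤?_; _<?_; 0ℤ; 1ℤ; -1ℤ; +<+; -<-)
open import Data.Integer.Properties
  using (≤-refl; ≤-trans; ≤-antisym; <⇒≤; ≰⇒>; ≤-<-trans; +-comm; +-mono-≤; +-monoˡ-≤; +-monoʳ-≤; +-monoʳ-<;
         i<j⇒suc[i]≤j; suc[i]≤j⇒i<j)
open import Data.Integer.Tactic.RingSolver using (solve-∀)
open import Data.List using ([]; _∷_; length; filter)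
open import Data.List.Membership.Propositional using (_∈_)
open import Data.List.Relation.Binary.Permutation.Propositional
  using (_↭_; refl; prep; swap; ↭-sym; ↭-trans; module PermutationReasoning)
open import Data.List.Relation.Binary.Permutation.Propositional.Properties using (∈-resp-↭; drop-∷; filter-↭; ↭-length)
import Data.List.Relation.Unary.All as List
open import Data.List.Relation.Unary.Any using (here)
open import Data.Nat using (ℕ; zero; suc; s≤s)
open import Data.Product using (_×_; _,_)
open import Data.Unit using (⊤; tt)
open import Data.Vec using (Vec; []; _∷_; toList)
open import Data.Vec.Relation.Binary.Pointwise.Inductive using (Pointwise; []; _∷_)
open import Data.Vec.Relation.Unary.All using (All; []; _∷_; universal)
open import Data.Vec.Relation.Unary.All.Properties using (map⁺; toList⁺)
open import Function using (_∘_)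
open import Relation.Binary.PropositionalEquality
  using (_≡_; refl; sym; cong; cong₂; subst; subst₂; module ≡-Reasoning)
open import Relation.Nullary using (yes; no)

private
  variable
    n : ℕ

partition-tail : ∀ {x} {xs : Vec ℤ n} → IsGenPartition (x ∷ xs) → IsGenPartition xs
partition-tail {xs = []} _ = tt
partition-tail {xs = _ ∷ _} (_ , p) = p

partition-cons : ∀ {x} {xs : Vec ℤ n} → All (_≤ x) xs → IsGenPartition xs → IsGenPartition (x ∷ xs)
partition-cons [] _ = tt
partition-cons (y≤x ∷ _) p = y≤x , p

tail-≤-head : ∀ {x} {xs : Vec ℤ n} → IsGenPartition (x ∷ xs) → All (_≤ x) xs
tail-≤-head {xs = []} _ = []
tail-≤-head {xs = _ ∷ _} (y≤x , p) = y≤x ∷ weaken (tail-≤-head p)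
  where
  weaken : ∀ {m} {zs : Vec ℤ m} → All (_≤ _) zs → All (_≤ _) zs
  weaken [] = []
  weaken (z≤y ∷ zs≤y) = ≤-trans z≤y y≤x ∷ weaken zs≤y

partition-⊕ : {u v : Vec ℤ n} → IsGenPartition u → IsGenPartition v → IsGenPartition (u ⊕ v)
partition-⊕ {u = []} {[]} _ _ = tt
partition-⊕ {u = _ ∷ []} {_ ∷ []} _ _ = tt
partition-⊕ {u = _ ∷ _ ∷ _} {_ ∷ _ ∷ _} (p , u) (q , v) = +-mono-≤ p q , partition-⊕ u v

∈-partition⇒≤-head : ∀ {x w} {xs : Vec ℤ n} → IsGenPartition (x ∷ xs) → w ∈ toList (x ∷ xs) → w ≤ x
∈-partition⇒≤-head p = List.lookup (toList⁺ (≤-refl ∷ tail-≤-head p))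

sorted-↭⇒≡ : {u v : Vec ℤ n} → IsGenPartition u → IsGenPartition v → toList u ↭ toList v → u ≡ v
sorted-↭⇒≡ {u = []} {[]} _ _ _ = refl
sorted-↭⇒≡ {u = x ∷ xs} {y ∷ ys} pu pv u↭v
  with ≤-antisym (∈-partition⇒≤-head pv (∈-resp-↭ u↭v (here refl)))
                 (∈-partition⇒≤-head pu (∈-resp-↭ (↭-sym u↭v) (here refl)))
... | refl = cong (x ∷_) (sorted-↭⇒≡ (partition-tail pu) (partition-tail pv) (drop-∷ u↭v))

All-insert : ∀ {P : ℤ → Set} {a} {ys : Vec ℤ n} → P a → All P ys → All P (insert a ys)
All-insert {ys = []} pa [] = pa ∷ []
All-insert {a = a} {ys = y ∷ ys} pa (py ∷ pys) with y ≤? a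
... | yes _ = pa ∷ py ∷ pys
... | no _ = py ∷ All-insert pa pys

insert-partition : ∀ a {ys : Vec ℤ n} → IsGenPartition ys → IsGenPartition (insert a ys)
insert-partition a {[]} _ = tt
insert-partition a {y ∷ ys} p with y ≤? a
... | yes y≤a = y≤a , p
... | no y≰a = partition-cons (All-insert (<⇒≤ (≰⇒> y≰a)) (tail-≤-head p)) (insert-partition a (partition-tail p))

sort-partition : (xs : Vec ℤ n) → IsGenPartition (sort xs)
sort-partition [] = tt
sort-partition (x ∷ xs) = insert-partition x (sort-partition xs)

insert-↭ : ∀ a (ys : Vec ℤ n) → toList (insert a ys) ↭ a ∷ toList ys
insert-↭ a [] = refl
insert-↭ a (y ∷ ys) with y ≤? a
... | yes _ = refl
... | no _ = ↭-trans (prep y (insert-↭ a ys)) (swap y a refl)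

sort-↭ : (xs : Vec ℤ n) → toList (sort xs) ↭ toList xs
sort-↭ [] = refl
sort-↭ (x ∷ xs) = ↭-trans (insert-↭ x (sort xs)) (prep x (sort-↭ xs))

ConstantOnAscents : Vec ℤ n → Vec ℤ n → Set
ConstantOnAscents [] [] = ⊤
ConstantOnAscents (b ∷ fs) (a ∷ xs) = Pointwise (λ f x → a < x → f ≡ b) fs xs × ConstantOnAscents fs xs

StartsWithCopies : ℕ → ℤ → Vec ℤ n → Set
StartsWithCopies zero b _ = ⊤
StartsWithCopies (suc k) b [] = ⊥
StartsWithCopies (suc k) b (f ∷ fs) = f ≡ b × StartsWithCopies k b fs

countAbove : ℤ → Vec ℤ n → ℕ
countAbove a xs = length (filter (a <?_) (toList xs))

countAbove-sort : ∀ a (xs : Vec ℤ n) → countAbove a (sort xs) ≡ countAbove a xs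
countAbove-sort a xs = ↭-length (filter-↭ (a <?_) (sort-↭ xs))

-- insert a ys moves a past leading entries of ys that exceed a, at most countAbove a ys of
-- them; the entries of b ∷ fs beside them are all b, so the differences are only rotated.
insert-⊖-↭ : ∀ a b (fs ys : Vec ℤ n) → StartsWithCopies (countAbove a ys) b fs →
             toList ((b ∷ fs) ⊖ insert a ys) ↭ b - a ∷ toList (fs ⊖ ys)
insert-⊖-↭ a b [] [] _ = refl
insert-⊖-↭ a b (f ∷ fs) (y ∷ ys) copies with y ≤? a
... | yes _ = refl
... | no y≰a with a <? y | copies
...   | no a≮y | _ = ⊥-elim (a≮y (≰⇒> y≰a))
...   | yes _ | refl , copies′ =
  ↭-trans (prep (b - y) (insert-⊖-↭ a b fs ys copies′)) (swap (b - y) (b - a) refl)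

startsWithCopies-cons : ∀ k {f b} {fs : Vec ℤ n} → IsGenPartition (f ∷ fs) → f ≤ b →
                        StartsWithCopies k b fs → StartsWithCopies k b (f ∷ fs)
startsWithCopies-cons zero _ _ _ = tt
startsWithCopies-cons (suc k) {fs = []} _ _ ()
startsWithCopies-cons (suc k) {fs = _ ∷ _} (b≤f , p) f≤b (refl , copies) =
  ≤-antisym f≤b b≤f , startsWithCopies-cons k p ≤-refl copies

ascents⇒startsWithCopies : ∀ a b {fs xs : Vec ℤ n} → All (_≤ b) fs → IsGenPartition fs →
                           Pointwise (λ f x → a < x → f ≡ b) fs xs → StartsWithCopies (countAbove a xs) b fs
ascents⇒startsWithCopies a b [] _ [] = tt
ascents⇒startsWithCopies a b {xs = x ∷ _} (f≤b ∷ fs≤b) p (f≡b ∷ ascents) with a <? x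
... | yes a<x = f≡b a<x , ascents⇒startsWithCopies a b fs≤b (partition-tail p) ascents
... | no _ = startsWithCopies-cons _ p f≤b (ascents⇒startsWithCopies a b fs≤b (partition-tail p) ascents)

sort-⊖-↭ : (f x : Vec ℤ n) → IsGenPartition f → ConstantOnAscents f x → toList (f ⊖ sort x) ↭ toList (f ⊖ x)
sort-⊖-↭ [] [] _ _ = refl
sort-⊖-↭ (b ∷ fs) (a ∷ xs) p (ascents , ascents′) =
  ↭-trans (insert-⊖-↭ a b fs (sort xs) copies) (prep (b - a) (sort-⊖-↭ fs xs (partition-tail p) ascents′))
  where
  copies : StartsWithCopies (countAbove a (sort xs)) b fs
  copies = subst (λ k → StartsWithCopies k b fs) (sym (countAbove-sort a xs))
                 (ascents⇒startsWithCopies a b (tail-≤-head p) (partition-tail p) ascents)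

⊖-cancel : (f g : Vec ℤ n) → f ⊖ (f ⊖ g) ≡ g
⊖-cancel [] [] = refl
⊖-cancel (x ∷ f) (y ∷ g) = cong₂ _∷_ (x-[x-y]≡y x y) (⊖-cancel f g)
  where
  x-[x-y]≡y : ∀ x y → x - (x - y) ≡ y
  x-[x-y]≡y = solve-∀

sort-⊖-sort-⊖ : {f g : Vec ℤ n} → IsGenPartition f → IsGenPartition g → ConstantOnAscents f (f ⊖ g) →
                g ≡ sort (f ⊖ sort (f ⊖ g))
sort-⊖-sort-⊖ {f = f} {g} pf pg ascents = sorted-↭⇒≡ pg (sort-partition (f ⊖ sort (f ⊖ g))) (↭-sym rearranged)
  where
  open PermutationReasoning
  rearranged : toList (sort (f ⊖ sort (f ⊖ g))) ↭ toList g
  rearranged = begin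
    toList (sort (f ⊖ sort (f ⊖ g)))  ↭⟨ sort-↭ (f ⊖ sort (f ⊖ g)) ⟩
    toList (f ⊖ sort (f ⊖ g))         ↭⟨ sort-⊖-↭ f (f ⊖ g) pf ascents ⟩
    toList (f ⊖ (f ⊖ g))              ≡⟨ cong toList (⊖-cancel f g) ⟩
    toList g                          ∎

data Step : Sign → ℤ → Set where
  stay : ∀ {σ} → Step σ 0ℤ
  up   : Step pos 1ℤ
  down : Step neg -1ℤ

step-< : ∀ {σ u v} → Step σ u → Step σ v → u < v → v ≡ 1ℤ + u
step-< stay stay (+<+ ())
step-< stay up _ = refl
step-< stay down ()
step-< up stay (+<+ ())
step-< up up (+<+ (s≤s ()))
step-< down stay _ = refl
step-< down down (-<- ())

e-steps : ∀ {r} (S : SignedSubset r) → All (Step (SignedSubset.sign S)) (e S)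
e-steps (pos , A) = map⁺ (universal bit-up A)
  where
  bit-up : (b : Bool) → Step pos (if b then 1ℤ else 0ℤ)
  bit-up true = up
  bit-up false = stay
e-steps (neg , A) = map⁺ (map⁺ (universal bit-down A))
  where
  bit-down : (b : Bool) → Step neg (- (if b then 1ℤ else 0ℤ))
  bit-down true = down
  bit-down false = stay

-‿+-cancelˡ : ∀ i j → - i + (i + j) ≡ j
-‿+-cancelˡ = solve-∀

+-cancelˡ-≤ : ∀ i {j k} → i + j ≤ i + k → j ≤ k
+-cancelˡ-≤ i {j} {k} = subst₂ _≤_ (-‿+-cancelˡ i j) (-‿+-cancelˡ i k) ∘ +-monoʳ-≤ (- i)

+-cancelˡ-< : ∀ i {j k} → i + j < i + k → j < k
+-cancelˡ-< i {j} {k} = subst₂ _<_ (-‿+-cancelˡ i j) (-‿+-cancelˡ i k) ∘ +-monoʳ-< (- i)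

ascent-shape : ∀ {τ k t k′ t′} → Step τ t → Step τ t′ → k′ ≤ k → k + t < k′ + t′ →
               k′ ≡ k × t′ ≡ 1ℤ + t
ascent-shape {k = k} {t} {k′} tτ t′τ k′≤k x<x′
  with step-< tτ t′τ (+-cancelˡ-< k′ (≤-<-trans (+-monoˡ-≤ t k′≤k) x<x′))
... | refl = ≤-antisym k′≤k k≤k′ , refl
  where
  regroup : ∀ k t → 1ℤ + (k + t) ≡ 1ℤ + t + k
  regroup = solve-∀
  k≤k′ : k ≤ k′
  k≤k′ = +-cancelˡ-≤ (1ℤ + t) (subst₂ _≤_ (regroup k t) (+-comm k′ (1ℤ + t)) (i<j⇒suc[i]≤j x<x′))

ascent-level : ∀ {σ τ k s t k′ s′ t′} → Step σ s → Step σ s′ → Step τ t → Step τ t′ →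
               k′ ≤ k → k′ + s′ + t′ ≤ k + s + t → k + t < k′ + t′ →
               k′ + s′ + t′ + k′ ≡ k + s + t + k
ascent-level {k = k} {s} {t} {s′ = s′} sσ s′σ tτ t′τ k′≤k ν′≤ν x<x′ with ascent-shape tτ t′τ k′≤k x<x′
... | refl , refl = begin
    k + s′ + (1ℤ + t) + k    ≡⟨ shift k s′ t ⟩
    k + (1ℤ + s′) + t + k    ≡⟨ cong (λ a → k + a + t + k) s≡1+s′ ⟨
    k + s + t + k            ∎
  where
  open ≡-Reasoning
  shift : ∀ k s′ t → k + s′ + (1ℤ + t) + k ≡ k + (1ℤ + s′) + t + k
  shift = solve-∀
  regroup′ : ∀ k s′ t → k + s′ + (1ℤ + t) ≡ k + t + (1ℤ + s′)
  regroup′ = solve-∀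
  regroup : ∀ k s t → k + s + t ≡ k + t + s
  regroup = solve-∀
  s≡1+s′ : s ≡ 1ℤ + s′
  s≡1+s′ = step-< s′σ sσ (suc[i]≤j⇒i<j (+-cancelˡ-≤ (k + t) s′+1≤s))
    where
    s′+1≤s : k + t + (1ℤ + s′) ≤ k + t + s
    s′+1≤s = subst₂ _≤_ (regroup′ k s′ t) (regroup k s t) ν′≤ν

[k+s+t+k]-[k+s]≡k+t : ∀ k s t → k + s + t + k - (k + s) ≡ k + t
[k+s+t+k]-[k+s]≡k+t = solve-∀

head-ascents-level : ∀ {σ τ k s t} {ks ss ts : Vec ℤ n} →
                     Step σ s → Step τ t → All (Step σ) ss → All (Step τ) ts →
                     All (_≤ k) ks → All (_≤ k + s + t) (ks ⊕ ss ⊕ ts) →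
                     Pointwise (λ f x → k + s + t + k - (k + s) < x → f ≡ k + s + t + k)
                               (ks ⊕ ss ⊕ ts ⊕ ks) (ks ⊕ ss ⊕ ts ⊕ ks ⊖ (ks ⊕ ss))
head-ascents-level {ks = []} _ _ [] [] [] [] = []
head-ascents-level {k = k} {s} {t} {k′ ∷ _} {s′ ∷ _} {t′ ∷ _}
                   sσ tτ (s′σ ∷ ssσ) (t′τ ∷ tsτ) (k′≤k ∷ ks≤k) (ν′≤ν ∷ νs≤ν) =
  (λ x<x′ → ascent-level sσ s′σ tτ t′τ k′≤k ν′≤ν
              (subst₂ _<_ ([k+s+t+k]-[k+s]≡k+t k s t) ([k+s+t+k]-[k+s]≡k+t k′ s′ t′) x<x′))
  ∷ head-ascents-level sσ tτ ssσ tsτ ks≤k νs≤ν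

ascents-constant : ∀ {σ τ} (κ : Vec ℤ n) {s t} → All (Step σ) s → All (Step τ) t →
                   IsGenPartition κ → IsGenPartition (κ ⊕ s ⊕ t) →
                   ConstantOnAscents (κ ⊕ s ⊕ t ⊕ κ) (κ ⊕ s ⊕ t ⊕ κ ⊖ (κ ⊕ s))
ascents-constant [] [] [] _ _ = tt
ascents-constant (_ ∷ κ) (sσ ∷ ssσ) (tτ ∷ tsτ) pκ pν =
  head-ascents-level sσ tτ ssσ tsτ (tail-≤-head pκ) (tail-≤-head pν) ,
  ascents-constant κ ssσ tsτ (partition-tail pκ) (partition-tail pν)

lemma3p4 : (r : ℕ) (κ λ' ν : Vec ℤ r) (S T : SignedSubset r) →
    IsGenPartition κ → IsGenPartition λ' → IsGenPartition ν →
    λ' ≡ κ ⊕ e S → ν ≡ λ' ⊕ e T →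
    λ' ≡ sort (ν ⊕ κ ⊖ sort (ν ⊕ κ ⊖ λ'))
lemma3p4 r κ _ _ S T pκ pλ pν refl refl =
  sort-⊖-sort-⊖ (partition-⊕ pν pκ) pλ (ascents-constant κ (e-steps S) (e-steps T) pκ pν)
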